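{- Let $G$ be a connected bipartite graph of order $n=r+s\ge 4$ with stable sets $U$ and $W$, $|U|=r\le s=|W|$. If $r\ge 3$ and $\lambda(\overline{G})=\lambda(G)+1$, then $\frac{3r}{2}+1\le s\le 2^r-1$.
   Context: A set $S$ of vertices is distinguishing if $N(x)\cap S\neq N(y)\cap S$ for all distinct vertices $x,y\notin S$ ($N$ = open neighborhood); a locating-dominating set is a distinguishing set $S$ such that every vertex not in $S$ has a neighbor in $S$. $\lambda(G)$ is the minimum cardinality of a locating-dominating set of $G$, and $\overline{G}$ is the complement of $G$. -}

module Defs where

open import Data.Nat using (ℕ; suc; _≤_)
open import Data.Bool using (Bool; true; false; not; if_then_else_)
open import Data.Fin using (Fin)
open import Data.Fin.Properties using (_≟_)
open import Data.Fin.Subset using (Subset; _∈_; _∉_; ∣_∣)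
open import Data.Product using (Σ; _×_; ∃)
open import Relation.Nullary using (¬_)
open import Relation.Nullary.Decidable using (⌊_⌋)
open import Relation.Binary.PropositionalEquality using (_≡_; _≢_)

record Graph (n : ℕ) : Set where
  field
    adj   : Fin n → Fin n → Bool
    sym   : ∀ x y → adj x y ≡ adj y x
    irrefl : ∀ x → adj x x ≡ false
open Graph public

compl : ∀ {n} → Graph n → Graph n
compl {n} G = record { adj = a ; sym = s ; irrefl = i }
  where
  a : Fin n → Fin n → Bool
  a x y = if ⌊ x ≟ y ⌋ then false else not (adj G x y)
  s : ∀ x y → a x y ≡ a y x
  s x y with x ≟ y | y ≟ x
  ... | Relation.Nullary.yes _ | Relation.Nullary.yes _ = Relation.Binary.PropositionalEquality.refl
  ... | Relation.Nullary.yes p | Relation.Nullary.no q = Data.Empty.⊥-elim (q (Relation.Binary.PropositionalEquality.sym p))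
    where import Data.Empty
  ... | Relation.Nullary.no p | Relation.Nullary.yes q = Data.Empty.⊥-elim (p (Relation.Binary.PropositionalEquality.sym q))
    where import Data.Empty
  ... | Relation.Nullary.no _ | Relation.Nullary.no _ = Relation.Binary.PropositionalEquality.cong not (sym G x y)
  i : ∀ x → a x x ≡ false
  i x with x ≟ x
  ... | Relation.Nullary.yes _ = Relation.Binary.PropositionalEquality.refl
  ... | Relation.Nullary.no p = Data.Empty.⊥-elim (p Relation.Binary.PropositionalEquality.refl)
    where import Data.Empty

data Reachable {n : ℕ} (G : Graph n) : Fin n → Fin n → Set where
  here : ∀ {x} → Reachable G x x
  step : ∀ {x y z} → adj G x y ≡ true → Reachable G y z → Reachable G x z

Connected : ∀ {n} → Graph n → Set
Connected {n} G = ∀ (x y : Fin n) → Reachable G x y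

Distinguishing : ∀ {n} → Graph n → Subset n → Set
Distinguishing {n} G S = ∀ (x y : Fin n) → x ∉ S → y ∉ S → x ≢ y →
  ¬ (∀ (z : Fin n) → z ∈ S → adj G x z ≡ adj G y z)

Dominating : ∀ {n} → Graph n → Subset n → Set
Dominating {n} G S = ∀ (x : Fin n) → x ∉ S → Σ (Fin n) (λ z → z ∈ S × adj G x z ≡ true)

LocDom : ∀ {n} → Graph n → Subset n → Set
LocDom G S = Distinguishing G S × Dominating G S

IsLambda : ∀ {n} → Graph n → ℕ → Set
IsLambda {n} G k = Σ (Subset n) (λ S → LocDom G S × ∣ S ∣ ≡ k)
                 × (∀ (S : Subset n) → LocDom G S → k ≤ ∣ S ∣)

BipartiteWith : ∀ {n} → Graph n → Subset n → Set
BipartiteWith {n} G U =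
  (∀ (x y : Fin n) → x ∈ U → y ∈ U → adj G x y ≡ false) ×
  (∀ (x y : Fin n) → x ∉ U → y ∉ U → adj G x y ≡ false)

module Submission where

-- Let S be a minimum locating-dominating set of G. A set is distinguishing in G iff it is
-- distinguishing in the complement, so λ(Ḡ) > |S| forces S to fail domination in Ḡ: some vertex x
-- is adjacent in G to all of S. By bipartiteness S is then the whole side A not containing x, and the
-- vertices of the other side B have pairwise distinct nonempty neighbourhoods in A, whence
-- |B| ≤ 2^|A| − 1. For a ∈ A and y ∈ B adjacent to a, the set (A − a) ∪ {y} would locate and
-- dominate Ḡ unless two vertices of B − y have neighbourhoods differing exactly in a; using this for
-- y = x and then for y the upper end of the pair found gives, for every a, two such "a-edges" among
-- the neighbourhood vectors of B. Contracting one direction at a time shows that s distinct 0/1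
-- vectors with two edges in each of r directions satisfy 3r ≤ 2(s − 1), so 3|A| + 2 ≤ 2|B|; for
-- A = W this contradicts r ≤ s, hence A = U.

open import Defs hiding (sym)
open import Data.Nat using (ℕ; suc; _≤_; _+_; _*_; _^_)
open import Data.Fin.Subset using (Subset; ∣_∣; ∁)
open import Data.Product using (Σ; _×_)

open import Data.Bool using (Bool; true; false; not)
open import Data.Bool.Properties using (¬-not; not-injective) renaming (_≟_ to _≟ᵇ_)
open import Data.Empty using (⊥-elim)
open import Data.Fin using (Fin; zero; suc)
open import Data.Fin.Properties using (_≟_; suc-injective; ¬∀⟶∃¬; any?)
open import Data.Fin.Subset using (inside; outside; _-_; _∪_; ⁅_⁆; _⊆_) renaming (_∈_ to _∈ₛ_; _∉_ to _∉ₛ_)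
open import Data.Fin.Subset.Properties
  using (_∈?_; ⊆-antisym; x∈p∪q⁺; x∈⁅x⁆; x∉⁅y⁆⇒x≢y; x∈p∧x≢y⇒x∈p-y; x∈p⇒∣p-x∣<∣p∣; ∣⁅x⁆∣≡1;
         x∈∁p⇒x∉p; x∉∁p⇒x∈p; x∉p⇒x∈∁p; x∈p⇒x∉∁p)
open import Data.List using (List; []; _∷_; length; filter; map)
open import Data.List.Properties using (filter-all; filter-none; length-map)
open import Data.List.Membership.Propositional using (_∈_; find; lose)
open import Data.List.Membership.Propositional.Properties using (∈-filter⁺; ∈-filter⁻; ∈-map⁺; ∈-map⁻)
open import Data.List.Relation.Unary.All as All using (All; []; _∷_)
open import Data.List.Relation.Unary.All.Properties using (¬Any⇒All¬)
open import Data.List.Relation.Unary.AllPairs using (AllPairs; []; _∷_)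
import Data.List.Relation.Unary.AllPairs.Properties as AllPairs
open import Data.List.Relation.Unary.Any as Any using (Any; here; there)
open import Data.List.Relation.Unary.Unique.Propositional using (Unique)
import Data.List.Relation.Unary.Unique.Propositional.Properties as Unique
open import Data.Nat using (_<_; z≤n; s≤s; pred)
open import Data.Nat.Properties
  using (module ≤-Reasoning; ≤-trans; ≤-reflexive; ≤-<-trans; <-≤-trans; <-irrefl; +-assoc; +-comm; +-suc; +-identityʳ;
         +-mono-≤; +-monoʳ-≤; +-monoˡ-≤; +-mono-≤-<; *-monoˡ-≤; *-monoʳ-≤; *-cancelˡ-≤; *-cancelˡ-<; <⇒≱;
         m≤m+n; m<m+n; m≤n⇒m≤1+n; n≤1+n)
open import Data.Nat.Tactic.RingSolver using (solve-∀)
open import Data.Product using (∃; ∃₂; _,_; proj₁; proj₂)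
open import Data.Sum using (_⊎_; inj₁; inj₂)
open import Data.Vec using ([]; _∷_; here; there)
open import Function using (_∘_)
open import Relation.Binary.Definitions using (DecidableEquality)
open import Relation.Binary.PropositionalEquality using (_≡_; _≢_; refl; sym; trans; cong; subst; subst₂)
open import Relation.Nullary using (¬_; Dec; yes; no)
open import Relation.Nullary.Decidable using (¬?; _×-dec_; _→-dec_)
open import Relation.Unary using (Decidable)
open import Relation.Unary.Properties using (∁?; _∪?_)

module _ {A : Set} where

  AllPairs-∈ : ∀ {R : A → A → Set} {xs x y} → AllPairs R xs → x ∈ xs → y ∈ xs → x ≢ y → R x y ⊎ R y x
  AllPairs-∈ (_ ∷ _)   (here refl) (here refl) x≢y = ⊥-elim (x≢y refl)
  AllPairs-∈ (Rx ∷ _)  (here refl) (there y∈) _   = inj₁ (All.lookup Rx y∈)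
  AllPairs-∈ (Ry ∷ _)  (there x∈)  (here refl) _  = inj₂ (All.lookup Ry x∈)
  AllPairs-∈ (_ ∷ Rxs) (there x∈)  (there y∈) x≢y = AllPairs-∈ Rxs x∈ y∈ x≢y

  AllPairs-map-∈ : ∀ {R S : A → A → Set} {xs} → (∀ {x y} → x ∈ xs → y ∈ xs → R x y → S x y) →
    AllPairs R xs → AllPairs S xs
  AllPairs-map-∈ h []          = []
  AllPairs-map-∈ h (Rx ∷ Rxs) = All.tabulate (λ y∈ → h (here refl) (there y∈) (All.lookup Rx y∈))
                              ∷ AllPairs-map-∈ (λ x∈ y∈ → h (there x∈) (there y∈)) Rxs

  AllPairs-filter⁺ : ∀ {R S : A → A → Set} {P : A → Set} (P? : Decidable P) {xs} →
    (∀ {x y} → x ∈ xs → y ∈ xs → P x → P y → R x y → S x y) →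
    AllPairs R xs → AllPairs S (filter P? xs)
  AllPairs-filter⁺ {R = R} {S} P? {xs} h Rxs = AllPairs-map-∈ restrict (AllPairs.filter⁺ P? Rxs)
    where
    restrict : ∀ {x y} → x ∈ filter P? xs → y ∈ filter P? xs → R x y → S x y
    restrict x∈ y∈ with ∈-filter⁻ P? x∈ | ∈-filter⁻ P? y∈
    ... | x∈xs , Px | y∈xs , Py = h x∈xs y∈xs Px Py

  length-filter-∁ : ∀ {P : A → Set} (P? : Decidable P) xs →
    length xs ≡ length (filter P? xs) + length (filter (∁? P?) xs)
  length-filter-∁ P? [] = refl
  length-filter-∁ P? (x ∷ xs) with P? x
  ... | yes _ = cong suc (length-filter-∁ P? xs)
  ... | no _  = trans (cong suc (length-filter-∁ P? xs)) (sym (+-suc _ _))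

  ∈⇒1≤length : ∀ {x : A} {xs} → x ∈ xs → 1 ≤ length xs
  ∈⇒1≤length {xs = _ ∷ _} _ = s≤s z≤n

  ∈-≢⇒2≤length : ∀ {x y : A} {xs} → x ∈ xs → y ∈ xs → x ≢ y → 2 ≤ length xs
  ∈-≢⇒2≤length {xs = _ ∷ []}    (here refl) (here refl) x≢y = ⊥-elim (x≢y refl)
  ∈-≢⇒2≤length {xs = _ ∷ _ ∷ _} _           _           _   = s≤s (s≤s z≤n)

  count : ∀ {P : A → Set} → Decidable P → List A → ℕ
  count P? xs = length (filter P? xs)

  count-mono : ∀ {P Q : A → Set} (P? : Decidable P) (Q? : Decidable Q) xs →
    (∀ {x} → x ∈ xs → P x → Q x) → count P? xs ≤ count Q? xs
  count-mono P? Q? [] _ = z≤n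
  count-mono P? Q? (x ∷ xs) P⇒Q with P? x | Q? x | count-mono P? Q? xs (P⇒Q ∘ there)
  ... | yes Px | no ¬Qx | _  = ⊥-elim (¬Qx (P⇒Q (here refl) Px))
  ... | yes _  | yes _  | ih = s≤s ih
  ... | no _   | yes _  | ih = m≤n⇒m≤1+n ih
  ... | no _   | no _   | ih = ih

  count-∪ : ∀ {Q R : A → Set} (Q? : Decidable Q) (R? : Decidable R) xs →
    count (Q? ∪? R?) xs ≤ count Q? xs + count R? xs
  count-∪ Q? R? [] = z≤n
  count-∪ Q? R? (x ∷ xs) with Q? x | R? x | count-∪ Q? R? xs
  ... | yes _ | yes _ | ih = s≤s (≤-trans ih (+-monoʳ-≤ _ (n≤1+n _)))
  ... | yes _ | no _  | ih = s≤s ih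
  ... | no _  | yes _ | ih = ≤-trans (s≤s ih) (≤-reflexive (sym (+-suc _ _)))
  ... | no _  | no _  | ih = ih

  count-⊎ : ∀ {P Q R : A → Set} (P? : Decidable P) (Q? : Decidable Q) (R? : Decidable R) xs →
    (∀ {x} → x ∈ xs → P x → Q x ⊎ R x) → count P? xs ≤ count Q? xs + count R? xs
  count-⊎ P? Q? R? xs P⇒Q⊎R = ≤-trans (count-mono P? (Q? ∪? R?) xs P⇒Q⊎R) (count-∪ Q? R? xs)

  module _ (_≟_ : DecidableEquality A) where

    ∃≢ : ∀ {xs} → Unique xs → 2 ≤ length xs → ∀ x → ∃ λ y → y ∈ xs × y ≢ x
    ∃≢ {_ ∷ []} _ (s≤s ())
    ∃≢ {y ∷ z ∷ _} ((y≢z ∷ _) ∷ _) _ x with y ≟ x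
    ... | no y≢x    = y , here refl , y≢x
    ... | yes refl  = z , there (here refl) , y≢z ∘ sym

elements : ∀ {n} → Subset n → List (Fin n)
elements []            = []
elements (inside  ∷ p) = zero ∷ map suc (elements p)
elements (outside ∷ p) = map suc (elements p)

∈-elements⁺ : ∀ {n} {p : Subset n} {x} → x ∈ₛ p → x ∈ elements p
∈-elements⁺ {p = inside  ∷ p} here       = here refl
∈-elements⁺ {p = inside  ∷ p} (there x∈) = there (∈-map⁺ suc (∈-elements⁺ x∈))
∈-elements⁺ {p = outside ∷ p} (there x∈) = ∈-map⁺ suc (∈-elements⁺ x∈)

∈-elements⁻ : ∀ {n} {p : Subset n} {x} → x ∈ elements p → x ∈ₛ p
∈-elements⁻ {p = inside  ∷ p} (here refl) = here
∈-elements⁻ {p = inside  ∷ p} (there x∈) with ∈-map⁻ suc x∈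
... | _ , y∈ , refl = there (∈-elements⁻ y∈)
∈-elements⁻ {p = outside ∷ p} x∈ with ∈-map⁻ suc x∈
... | _ , y∈ , refl = there (∈-elements⁻ y∈)

elements-Unique : ∀ {n} (p : Subset n) → Unique (elements p)
elements-Unique []            = []
elements-Unique (inside  ∷ p) = All.tabulate zero∉ ∷ Unique.map⁺ suc-injective (elements-Unique p)
  where
  zero∉ : ∀ {y} → y ∈ map suc (elements p) → zero ≢ y
  zero∉ y∈ refl with ∈-map⁻ suc y∈
  ... | _ , _ , ()
elements-Unique (outside ∷ p) = Unique.map⁺ suc-injective (elements-Unique p)

length-elements : ∀ {n} (p : Subset n) → length (elements p) ≡ ∣ p ∣
length-elements []            = refl
length-elements (inside  ∷ p) = cong suc (trans (length-map suc (elements p)) (length-elements p))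
length-elements (outside ∷ p) = trans (length-map suc (elements p)) (length-elements p)

weighted-+ : ∀ h₁ h₂ x₁ x₂ → (2 * h₁ + h₂) + (2 * x₁ + x₂) ≡ 2 * (h₁ + x₁) + (h₂ + x₂)
weighted-+ = solve-∀

3r≤2pred⇒3r+2≤2s : ∀ {r s} → 1 ≤ s → 2 * r + r ≤ 2 * pred s → 3 * r + 2 ≤ 2 * s
3r≤2pred⇒3r+2≤2s {r} {suc s} _ 3r≤2s = begin
  3 * r + 2       ≡⟨ lemma r ⟩
  (2 * r + r) + 2 ≤⟨ +-monoˡ-≤ 2 3r≤2s ⟩
  2 * s + 2       ≡⟨ lemma′ s ⟩
  2 * suc s       ∎
  where
  open ≤-Reasoning
  lemma : ∀ r → 3 * r + 2 ≡ (2 * r + r) + 2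
  lemma = solve-∀
  lemma′ : ∀ s → 2 * s + 2 ≡ 2 * suc s
  lemma′ = solve-∀

3s+2≤2r⇒s<r : ∀ {r s} → 3 * s + 2 ≤ 2 * r → s < r
3s+2≤2r⇒s<r {r} {s} 3s+2≤2r = *-cancelˡ-< 2 s r (<-≤-trans 2s<3s+2 3s+2≤2r)
  where
  2s<3s+2 : 2 * s < 3 * s + 2
  2s<3s+2 = ≤-<-trans (*-monoˡ-≤ s (n≤1+n 2)) (m<m+n (3 * s) (s≤s z≤n))

pred-+-slack : ∀ {l r} → 1 ≤ l → 1 ≤ r → suc l + (2 * pred r + pred l) ≡ 2 * pred (l + r)
pred-+-slack {suc l} {suc r} _ _ = lemma l r
  where
  lemma : ∀ l r → suc (suc l) + (2 * r + l) ≡ 2 * (l + suc r)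
  lemma = solve-∀

-- A point p : P is read as the 0/1-vector c ↦ f p c.
module Traces {P C : Set} (_≟ᴾ_ : DecidableEquality P) (_≟ᶜ_ : DecidableEquality C) (f : P → C → Bool) where

  Separates : List C → P → P → Set
  Separates cs p q = Any (λ c → f p c ≢ f q c) cs

  Agree : List C → P → P → Set
  Agree cs p q = All (λ c → f p c ≡ f q c) cs

  Separated : List C → List P → Set
  Separated cs = AllPairs (Separates cs)

  separates⇒¬agree : ∀ {cs p q} → Separates cs p q → ¬ Agree cs p q
  separates⇒¬agree (here fp≢fq) (fp≡fq ∷ _) = fp≢fq fp≡fq
  separates⇒¬agree (there sep)  (_ ∷ agree) = separates⇒¬agree sep agree

  separates-sym : ∀ {cs p q} → Separates cs p q → Separates cs q p
  separates-sym = Any.map (λ fp≢fq fq≡fp → fp≢fq (sym fq≡fp))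

  Separated-∈ : ∀ {cs F p q} → Separated cs F → p ∈ F → q ∈ F → p ≢ q → Separates cs p q
  Separated-∈ sep p∈ q∈ p≢q with AllPairs-∈ sep p∈ q∈ p≢q
  ... | inj₁ s = s
  ... | inj₂ s = separates-sym s

  Separated-injective : ∀ {cs F p q} → Separated cs F → p ∈ F → q ∈ F → Agree cs p q → p ≡ q
  Separated-injective {p = p} {q} sep p∈ q∈ agree with p ≟ᴾ q
  ... | yes p≡q = p≡q
  ... | no p≢q  = ⊥-elim (separates⇒¬agree (Separated-∈ sep p∈ q∈ p≢q) agree)

  separates-∷⁻ : ∀ {c cs p q} → f p c ≡ f q c → Separates (c ∷ cs) p q → Separates cs p q
  separates-∷⁻ fp≡fq (here fp≢fq) = ⊥-elim (fp≢fq fp≡fq)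
  separates-∷⁻ _     (there sep)  = sep

  NonzeroOn : List C → P → Set
  NonzeroOn cs p = Any (λ c → f p c ≡ true) cs

  module _ (c : C) where

    Up : P → Set
    Up p = f p c ≡ true

    up? : Decidable Up
    up? p = f p c ≟ᵇ true

    Separated-up⁻ : ∀ {cs F} → Separated (c ∷ cs) F → Separated cs (filter up? F)
    Separated-up⁻ = AllPairs-filter⁺ up? (λ _ _ p-up q-up → separates-∷⁻ (trans p-up (sym q-up)))

    Separated-down⁻ : ∀ {cs F} → Separated (c ∷ cs) F → Separated cs (filter (∁? up?) F)
    Separated-down⁻ = AllPairs-filter⁺ (∁? up?) (λ _ _ p-down q-down → separates-∷⁻ (trans (¬-not p-down) (sym (¬-not q-down))))

  Separated-length≤ : ∀ cs {F} → Separated cs F → length F ≤ 2 ^ length cs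
  Separated-length≤ [] []           = z≤n
  Separated-length≤ [] (_ ∷ [])     = s≤s z≤n
  Separated-length≤ [] ((() ∷ _) ∷ _)
  Separated-length≤ (c ∷ cs) {F} sep = begin
    length F                                          ≡⟨ length-filter-∁ (up? c) F ⟩
    length (filter (up? c) F) + length (filter (∁? (up? c)) F)
      ≤⟨ +-mono-≤ (Separated-length≤ cs (Separated-up⁻ c sep)) (Separated-length≤ cs (Separated-down⁻ c sep)) ⟩
    2 ^ length cs + 2 ^ length cs                     ≡⟨ cong (2 ^ length cs +_) (sym (+-identityʳ _)) ⟩
    2 ^ suc (length cs)                               ∎
    where open ≤-Reasoning

  Separated-length< : ∀ cs {F} → Separated cs F → All (NonzeroOn cs) F → length F < 2 ^ length cs
  Separated-length< [] {[]} _ _ = s≤s z≤n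
  Separated-length< [] {_ ∷ _} _ (() ∷ _)
  Separated-length< (c ∷ cs) {F} sep nonzero = begin-strict
    length F                                          ≡⟨ length-filter-∁ (up? c) F ⟩
    length (filter (up? c) F) + length (filter (∁? (up? c)) F)
      <⟨ +-mono-≤-< (Separated-length≤ cs (Separated-up⁻ c sep)) (Separated-length< cs (Separated-down⁻ c sep) nonzero-down) ⟩
    2 ^ length cs + 2 ^ length cs                     ≡⟨ cong (2 ^ length cs +_) (sym (+-identityʳ _)) ⟩
    2 ^ suc (length cs)                               ∎
    where
    open ≤-Reasoning
    nonzero-down : All (NonzeroOn cs) (filter (∁? (up? c)) F)
    nonzero-down = All.tabulate λ p∈ → let p∈F , p-down = ∈-filter⁻ (∁? (up? c)) p∈ in
      drop-up p-down (All.lookup nonzero p∈F)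
      where
      drop-up : ∀ {p} → ¬ Up c p → NonzeroOn (c ∷ cs) p → NonzeroOn cs p
      drop-up p-down (here p-up) = ⊥-elim (p-down p-up)
      drop-up _     (there nz)  = nz

  Edge : List C → C → P → P → Set
  Edge cs d p q = f p d ≡ false × f q d ≡ true × All (λ c → c ≢ d → f p c ≡ f q c) cs

  edge? : ∀ cs d p q → Dec (Edge cs d p q)
  edge? cs d p q = (f p d ≟ᵇ false) ×-dec (f q d ≟ᵇ true) ×-dec All.all? (λ c → ¬? (c ≟ᶜ d) →-dec (f p c ≟ᵇ f q c)) cs

  edge-agrees : ∀ {cs d p q c} → Edge cs d p q → c ∈ cs → c ≢ d → f p c ≡ f q c
  edge-agrees (_ , _ , agree) c∈ c≢d = All.lookup agree c∈ c≢d

  edges-agree : ∀ {cs d p q q′} → Edge cs d p q → Edge cs d p q′ → Agree cs q q′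
  edges-agree {cs} {d} {p} {q} {q′} e e′ = All.tabulate q~q′
    where
    q~q′ : ∀ {c} → c ∈ cs → f q c ≡ f q′ c
    q~q′ {c} c∈ with c ≟ᶜ d
    ... | yes refl = trans (proj₁ (proj₂ e)) (sym (proj₁ (proj₂ e′)))
    ... | no c≢d   = trans (sym (edge-agrees e c∈ c≢d)) (edge-agrees e′ c∈ c≢d)

  LowerEnd : List C → List P → C → P → Set
  LowerEnd cs F d p = Any (Edge cs d p) F

  lowerEnd? : ∀ cs F d → Decidable (LowerEnd cs F d)
  lowerEnd? cs F d p = Any.any? (edge? cs d p) F

  HasEdge : List C → List P → C → Set
  HasEdge cs F d = Any (LowerEnd cs F d) F

  hasEdge? : ∀ cs F → Decidable (HasEdge cs F)
  hasEdge? cs F d = Any.any? (lowerEnd? cs F d) F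

  HasTwoEdges : List C → List P → C → Set
  HasTwoEdges cs F d = Any (λ p → LowerEnd cs F d p × Any (λ p′ → LowerEnd cs F d p′ × p ≢ p′) F) F

  hasTwoEdges? : ∀ cs F → Decidable (HasTwoEdges cs F)
  hasTwoEdges? cs F d = Any.any? (λ p → lowerEnd? cs F d p ×-dec Any.any? (λ p′ → lowerEnd? cs F d p′ ×-dec ¬? (p ≟ᴾ p′)) F) F

  ¬separates-off⇒agrees-off : ∀ {cs d p q} → ¬ Any (λ c → c ≢ d × f p c ≢ f q c) cs →
    ∀ {c} → c ∈ cs → c ≢ d → f p c ≡ f q c
  ¬separates-off⇒agrees-off {p = p} {q} ¬off-d {c} c∈ c≢d with f p c ≟ᵇ f q c
  ... | yes fp≡fq = fp≡fq
  ... | no fp≢fq  = ⊥-elim (¬off-d (lose c∈ (c≢d , fp≢fq)))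

  separates⇒off⊎edge : ∀ {cs d p q} → Separates cs p q →
    Any (λ c → c ≢ d × f p c ≢ f q c) cs ⊎ Edge cs d p q ⊎ Edge cs d q p
  separates⇒off⊎edge {cs} {d} {p} {q} sep with Any.any? (λ c → ¬? (c ≟ᶜ d) ×-dec ¬? (f p c ≟ᵇ f q c)) cs
  ... | yes off-d = inj₁ off-d
  ... | no ¬off-d with find sep
  ...   | c , c∈ , fp≢fq with c ≟ᶜ d
  ...     | no c≢d = ⊥-elim (¬off-d (lose c∈ (c≢d , fp≢fq)))
  ...     | yes refl with f p c ≟ᵇ false
  ...       | yes p-down = inj₂ (inj₁ (p-down , ¬-not (λ q-down → fp≢fq (trans p-down (sym q-down))) ,
                                       All.tabulate (¬separates-off⇒agrees-off ¬off-d)))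
  ...       | no p-up    = inj₂ (inj₂ (¬-not (λ q-up → fp≢fq (trans (¬-not p-up) (sym q-up))) , ¬-not p-up ,
                                       All.tabulate (λ c′∈ c′≢d → sym (¬separates-off⇒agrees-off ¬off-d c′∈ c′≢d))))

  -- Contract the a-edges by merging each lower end with its upper end: the merged family R is still
  -- separated, d-edges survive in R, and two d-edges merging into one span a square whose lower
  -- side is a d-edge among the lower ends L.
  module Contract (a : C) (cs : List C) (a∉cs : All (a ≢_) cs) (F : List P) (sep : Separated (a ∷ cs) F) where

    Lower : P → Set
    Lower = LowerEnd (a ∷ cs) F a

    lower? : Decidable Lower
    lower? = lowerEnd? (a ∷ cs) F a

    L R : List P
    L = filter lower? F
    R = filter (∁? lower?) F

    ∈-cs⇒≢a : ∀ {c} → c ∈ cs → c ≢ a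
    ∈-cs⇒≢a c∈ c≡a = All.lookup a∉cs c∈ (sym c≡a)

    upper⇒¬lower : ∀ {q} → f q a ≡ true → ¬ Lower q
    upper⇒¬lower q-up lower with find lower
    ... | _ , _ , q-down , _ with () ← trans (sym q-up) q-down

    record Collapse (p : P) : Set where
      field
        image   : P
        image∈R : image ∈ R
        agrees  : Agree cs image p
        fixes   : ¬ Lower p → image ≡ p
        partner : Lower p → Edge (a ∷ cs) a p image

    open Collapse

    collapse : ∀ {p} → p ∈ F → Collapse p
    collapse {p} p∈ with lower? p
    ... | no ¬lower = record
      { image = p ; image∈R = ∈-filter⁺ (∁? lower?) p∈ ¬lower ; agrees = All.tabulate (λ _ → refl)
      ; fixes = λ _ → refl ; partner = λ lower → ⊥-elim (¬lower lower) }
    ... | yes lower with find lower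
    ...   | q , q∈ , e = record
      { image = q ; image∈R = ∈-filter⁺ (∁? lower?) q∈ (upper⇒¬lower (proj₁ (proj₂ e)))
      ; agrees = All.tabulate (λ c∈ → sym (edge-agrees e (there c∈) (∈-cs⇒≢a c∈)))
      ; fixes = λ ¬lower → ⊥-elim (¬lower lower) ; partner = λ _ → e }

    Edge-collapse : ∀ {d p q p′ q′} → d ∈ cs → Edge (a ∷ cs) d p q → Agree cs p′ p → Agree cs q′ q → Edge cs d p′ q′
    Edge-collapse d∈ e@(p-down , q-up , _) p′~p q′~q =
      trans (All.lookup p′~p d∈) p-down , trans (All.lookup q′~q d∈) q-up ,
      All.tabulate λ c∈ c≢d → trans (All.lookup p′~p c∈) (trans (edge-agrees e (there c∈) c≢d) (sym (All.lookup q′~q c∈)))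

    HasEdge-collapse : ∀ {d} → d ∈ cs → HasEdge (a ∷ cs) F d → HasEdge cs R d
    HasEdge-collapse d∈ has with find has
    ... | p , p∈ , lower with find lower
    ...   | q , q∈ , e = lose (image∈R cp) (lose (image∈R cq) (Edge-collapse d∈ e (agrees cp) (agrees cq)))
      where
      cp : Collapse p
      cp = collapse p∈
      cq : Collapse q
      cq = collapse q∈

    square⇒HasEdge : ∀ {d p₁ p₂ q₁ q₂} → d ∈ cs → p₁ ∈ F → p₂ ∈ F → q₁ ∈ F → q₂ ∈ F →
      Edge (a ∷ cs) a p₁ p₂ → Edge (a ∷ cs) d p₁ q₁ → Edge (a ∷ cs) d p₂ q₂ → HasEdge cs L d
    square⇒HasEdge {d} {p₁} {p₂} {q₁} {q₂} d∈ p₁∈ p₂∈ q₁∈ q₂∈ eₐ e₁ e₂ =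
      lose (∈-filter⁺ lower? p₁∈ (lose p₂∈ eₐ))
           (lose (∈-filter⁺ lower? q₁∈ (lose q₂∈ eₐ′))
                 (proj₁ e₁ , proj₁ (proj₂ e₁) , All.tabulate (λ c∈ → edge-agrees e₁ (there c∈))))
      where
      a≢d : a ≢ d
      a≢d a≡d = ∈-cs⇒≢a d∈ (sym a≡d)
      eₐ′ : Edge (a ∷ cs) a q₁ q₂
      eₐ′ = trans (sym (edge-agrees e₁ (here refl) a≢d)) (proj₁ eₐ)
          , trans (sym (edge-agrees e₂ (here refl) a≢d)) (proj₁ (proj₂ eₐ))
          , All.tabulate q₁~q₂
        where
        q₁~q₂ : ∀ {c} → c ∈ a ∷ cs → c ≢ a → f q₁ c ≡ f q₂ c
        q₁~q₂ {c} c∈ c≢a with c ≟ᶜ d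
        ... | yes refl = trans (proj₁ (proj₂ e₁)) (sym (proj₁ (proj₂ e₂)))
        ... | no c≢d   = trans (sym (edge-agrees e₁ c∈ c≢d)) (trans (edge-agrees eₐ c∈ c≢a) (edge-agrees e₂ c∈ c≢d))

    HasTwoEdges-collapse : ∀ {d} → d ∈ cs → HasTwoEdges (a ∷ cs) F d → HasTwoEdges cs R d ⊎ HasEdge cs L d
    HasTwoEdges-collapse d∈ two with find two
    ... | p₁ , p₁∈ , lower₁ , rest with find rest
    ... | p₂ , p₂∈ , lower₂ , p₁≢p₂ with find lower₁ | find lower₂
    ... | q₁ , q₁∈ , e₁ | q₂ , q₂∈ , e₂ =
      collapse-pair d∈ p₁∈ p₂∈ q₁∈ q₂∈ p₁≢p₂ e₁ e₂ (collapse p₁∈) (collapse p₂∈) (collapse q₁∈) (collapse q₂∈)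
      where
      collapse-pair : ∀ {d p₁ p₂ q₁ q₂} → d ∈ cs → p₁ ∈ F → p₂ ∈ F → q₁ ∈ F → q₂ ∈ F → p₁ ≢ p₂ →
        Edge (a ∷ cs) d p₁ q₁ → Edge (a ∷ cs) d p₂ q₂ → Collapse p₁ → Collapse p₂ → Collapse q₁ → Collapse q₂ →
        HasTwoEdges cs R d ⊎ HasEdge cs L d
      collapse-pair {d} {p₁} {p₂} d∈ p₁∈ p₂∈ q₁∈ q₂∈ p₁≢p₂ e₁ e₂ c₁ c₂ c₁′ c₂′ with image c₁ ≟ᴾ image c₂
      ... | no r₁≢r₂ = inj₁ (lose (image∈R c₁) (lose (image∈R c₁′) (Edge-collapse d∈ e₁ (agrees c₁) (agrees c₁′)) ,
                                lose (image∈R c₂) (lose (image∈R c₂′) (Edge-collapse d∈ e₂ (agrees c₂) (agrees c₂′)) , r₁≢r₂)))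
      ... | yes r₁≡r₂ with lower? p₁ | lower? p₂
      ...   | no ¬l₁ | no ¬l₂ = ⊥-elim (p₁≢p₂ (trans (sym (fixes c₁ ¬l₁)) (trans r₁≡r₂ (fixes c₂ ¬l₂))))
      ...   | yes l₁ | no ¬l₂ =
        inj₂ (square⇒HasEdge d∈ p₁∈ p₂∈ q₁∈ q₂∈
                (subst (Edge (a ∷ cs) a p₁) (trans r₁≡r₂ (fixes c₂ ¬l₂)) (partner c₁ l₁)) e₁ e₂)
      ...   | no ¬l₁ | yes l₂ =
        inj₂ (square⇒HasEdge d∈ p₂∈ p₁∈ q₂∈ q₁∈
                (subst (Edge (a ∷ cs) a p₂) (trans (sym r₁≡r₂) (fixes c₁ ¬l₁)) (partner c₂ l₂)) e₂ e₁)
      ...   | yes l₁ | yes l₂ = ⊥-elim (p₁≢p₂ (Separated-injective sep p₁∈ p₂∈ p₁~p₂))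
        where
        p₁~p₂ : Agree (a ∷ cs) p₁ p₂
        p₁~p₂ = trans (proj₁ (partner c₁ l₁)) (sym (proj₁ (partner c₂ l₂)))
              ∷ All.tabulate λ {c} c∈ → trans (sym (All.lookup (agrees c₁) c∈))
                                          (trans (cong (λ x → f x c) r₁≡r₂) (All.lookup (agrees c₂) c∈))

    Separated-L : Separated cs L
    Separated-L = AllPairs-filter⁺ lower? (λ _ _ lx ly → separates-∷⁻ (trans (down lx) (sym (down ly)))) sep
      where
      down : ∀ {p} → Lower p → f p a ≡ false
      down lower = proj₁ (proj₂ (proj₂ (find lower)))

    Separated-R : Separated cs R
    Separated-R = AllPairs-filter⁺ (∁? lower?) separate sep
      where
      separate : ∀ {p q} → p ∈ F → q ∈ F → ¬ Lower p → ¬ Lower q → Separates (a ∷ cs) p q → Separates cs p q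
      separate p∈ q∈ ¬lp ¬lq s with separates⇒off⊎edge s
      ... | inj₁ (here (a≢a , _)) = ⊥-elim (a≢a refl)
      ... | inj₁ (there off-a)    = Any.map proj₂ off-a
      ... | inj₂ (inj₁ e)         = ⊥-elim (¬lp (lose q∈ e))
      ... | inj₂ (inj₂ e)         = ⊥-elim (¬lq (lose p∈ e))

    length-F : length F ≡ length L + length R
    length-F = length-filter-∁ lower? F

    HasEdge⇒1≤length-L : HasEdge (a ∷ cs) F a → 1 ≤ length L
    HasEdge⇒1≤length-L has with find has
    ... | p , p∈ , lower = ∈⇒1≤length (∈-filter⁺ lower? p∈ lower)

    HasEdge⇒1≤length-R : HasEdge (a ∷ cs) F a → 1 ≤ length R
    HasEdge⇒1≤length-R has with find has
    ... | _ , _ , lower with find lower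
    ...   | q , q∈ , _ , q-up , _ = ∈⇒1≤length (∈-filter⁺ (∁? lower?) q∈ (upper⇒¬lower q-up))

    ¬HasEdge⇒length-L≡0 : ¬ HasEdge (a ∷ cs) F a → length L ≡ 0
    ¬HasEdge⇒length-L≡0 ¬has = cong length (filter-none lower? (¬Any⇒All¬ F ¬has))

    HasTwoEdges⇒2≤length-L : HasTwoEdges (a ∷ cs) F a → 2 ≤ length L
    HasTwoEdges⇒2≤length-L two with find two
    ... | p , p∈ , lower , rest with find rest
    ... | p′ , p′∈ , lower′ , p≢p′ = ∈-≢⇒2≤length (∈-filter⁺ lower? p∈ lower) (∈-filter⁺ lower? p′∈ lower′) p≢p′

  edge-count : ∀ cs F → Unique cs → Separated cs F →
    2 * count (hasEdge? cs F) cs + count (hasTwoEdges? cs F) cs ≤ 2 * pred (length F)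
  edge-count []       F _               _   = z≤n
  edge-count (a ∷ cs) F (a∉cs ∷ unique) sep = split-at-a
    where
    open Contract a cs a∉cs F sep
    x₁ x₂ : ℕ
    x₁ = count (hasEdge? (a ∷ cs) F) cs
    x₂ = count (hasTwoEdges? (a ∷ cs) F) cs

    count-bound : 2 * x₁ + x₂ ≤ 2 * pred (length R) + pred (length L)
    count-bound = begin
      2 * x₁ + x₂
        ≤⟨ +-mono-≤ (*-monoʳ-≤ 2 (count-mono (hasEdge? (a ∷ cs) F) (hasEdge? cs R) cs HasEdge-collapse))
                    (count-⊎ (hasTwoEdges? (a ∷ cs) F) (hasTwoEdges? cs R) (hasEdge? cs L) cs HasTwoEdges-collapse) ⟩
      2 * count (hasEdge? cs R) cs + (count (hasTwoEdges? cs R) cs + count (hasEdge? cs L) cs)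
        ≡⟨ sym (+-assoc (2 * count (hasEdge? cs R) cs) _ _) ⟩
      2 * count (hasEdge? cs R) cs + count (hasTwoEdges? cs R) cs + count (hasEdge? cs L) cs
        ≤⟨ +-mono-≤ (edge-count cs R unique Separated-R) L-bound ⟩
      2 * pred (length R) + pred (length L) ∎
      where
      open ≤-Reasoning
      L-bound : count (hasEdge? cs L) cs ≤ pred (length L)
      L-bound = *-cancelˡ-≤ 2 (≤-trans (m≤m+n _ _) (edge-count cs L unique Separated-L))

    with-slack : ∀ h → HasEdge (a ∷ cs) F a → h ≤ suc (length L) → h + (2 * x₁ + x₂) ≤ 2 * pred (length F)
    with-slack h has h≤ = begin
      h + (2 * x₁ + x₂)                                       ≤⟨ +-mono-≤ h≤ count-bound ⟩
      suc (length L) + (2 * pred (length R) + pred (length L)) ≡⟨ pred-+-slack (HasEdge⇒1≤length-L has) (HasEdge⇒1≤length-R has) ⟩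
      2 * pred (length L + length R)                          ≡⟨ cong (λ m → 2 * pred m) (sym length-F) ⟩
      2 * pred (length F)                                     ∎
      where open ≤-Reasoning

    split-at-a : 2 * count (hasEdge? (a ∷ cs) F) (a ∷ cs) + count (hasTwoEdges? (a ∷ cs) F) (a ∷ cs) ≤ 2 * pred (length F)
    split-at-a with hasEdge? (a ∷ cs) F a | hasTwoEdges? (a ∷ cs) F a
    ... | yes has | yes two = subst (_≤ 2 * pred (length F)) (weighted-+ 1 1 x₁ x₂) (with-slack 3 has (s≤s (HasTwoEdges⇒2≤length-L two)))
    ... | yes has | no _    = subst (_≤ 2 * pred (length F)) (weighted-+ 1 0 x₁ x₂) (with-slack 2 has (s≤s (HasEdge⇒1≤length-L has)))
    ... | no ¬has | yes two = ⊥-elim (¬has (Any.map proj₁ two))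
    ... | no ¬has | no _    = begin
      2 * x₁ + x₂                           ≤⟨ count-bound ⟩
      2 * pred (length R) + pred (length L) ≡⟨ cong (λ l → 2 * pred (length R) + pred l) L≡0 ⟩
      2 * pred (length R) + 0               ≡⟨ +-identityʳ _ ⟩
      2 * pred (length R)                   ≡⟨ cong (λ l → 2 * pred (l + length R)) (sym L≡0) ⟩
      2 * pred (length L + length R)        ≡⟨ cong (λ m → 2 * pred m) (sym length-F) ⟩
      2 * pred (length F)                   ∎
      where
      open ≤-Reasoning
      L≡0 : length L ≡ 0
      L≡0 = ¬HasEdge⇒length-L≡0 ¬has

∣p∪q∣≤∣p∣+∣q∣ : ∀ {n} (p q : Subset n) → ∣ p ∪ q ∣ ≤ ∣ p ∣ + ∣ q ∣
∣p∪q∣≤∣p∣+∣q∣ []            []            = z≤n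
∣p∪q∣≤∣p∣+∣q∣ (inside  ∷ p) (inside  ∷ q) = s≤s (≤-trans (∣p∪q∣≤∣p∣+∣q∣ p q) (+-monoʳ-≤ ∣ p ∣ (n≤1+n ∣ q ∣)))
∣p∪q∣≤∣p∣+∣q∣ (inside  ∷ p) (outside ∷ q) = s≤s (∣p∪q∣≤∣p∣+∣q∣ p q)
∣p∪q∣≤∣p∣+∣q∣ (outside ∷ p) (inside  ∷ q) = ≤-trans (s≤s (∣p∪q∣≤∣p∣+∣q∣ p q)) (≤-reflexive (sym (+-suc ∣ p ∣ ∣ q ∣)))
∣p∪q∣≤∣p∣+∣q∣ (outside ∷ p) (outside ∷ q) = ∣p∪q∣≤∣p∣+∣q∣ p q

∁-involutive : ∀ {n} (p : Subset n) → ∁ (∁ p) ≡ p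
∁-involutive p = ⊆-antisym (x∉∁p⇒x∈p ∘ x∈∁p⇒x∉p) (x∉p⇒x∈∁p ∘ x∈p⇒x∉∁p)

∈-∉⇒≢ : ∀ {n} {p : Subset n} {x y} → x ∈ₛ p → y ∉ₛ p → x ≢ y
∈-∉⇒≢ x∈ y∉ refl = y∉ x∈

module _ {n : ℕ} (G : Graph n) where

  adj-compl : ∀ {x y} → x ≢ y → adj (compl G) x y ≡ not (adj G x y)
  adj-compl {x} {y} x≢y with x ≟ y
  ... | yes x≡y = ⊥-elim (x≢y x≡y)
  ... | no _    = refl

  Distinguishing-compl : ∀ {S} → Distinguishing G S → Distinguishing (compl G) S
  Distinguishing-compl dist x y x∉ y∉ x≢y same = dist x y x∉ y∉ x≢y λ z z∈ →
    not-injective (trans (sym (adj-compl (∈-∉⇒≢ z∈ x∉ ∘ sym))) (trans (same z z∈) (adj-compl (∈-∉⇒≢ z∈ y∉ ∘ sym))))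

  ¬Dominating-compl⇒universal : ∀ {S} → ¬ Dominating (compl G) S →
    ∃ λ x → x ∉ₛ S × (∀ z → z ∈ₛ S → adj G x z ≡ true)
  ¬Dominating-compl⇒universal {S} ¬dom
    with ¬∀⟶∃¬ n _ (λ x → ¬? (x ∈? S) →-dec any? (λ z → (z ∈? S) ×-dec (adj (compl G) x z ≟ᵇ true))) ¬dom
  ... | x , ¬dominated with x ∈? S
  ...   | yes x∈ = ⊥-elim (¬dominated (λ x∉ → ⊥-elim (x∉ x∈)))
  ...   | no x∉  = x , x∉ , universal
    where
    universal : ∀ z → z ∈ₛ S → adj G x z ≡ true
    universal z z∈ with adj (compl G) x z ≟ᵇ true
    ... | yes x~z = ⊥-elim (¬dominated (λ _ → z , z∈ , x~z))
    ... | no x≁z  = not-injective (trans (sym (adj-compl (∈-∉⇒≢ z∈ x∉ ∘ sym))) (¬-not x≁z))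

  distinguishing-witness : ∀ {S i j} → ¬ (∀ z → z ∈ₛ S → adj G i z ≡ adj G j z) →
    ∃ λ z → z ∈ₛ S × adj G i z ≢ adj G j z
  distinguishing-witness {S} {i} {j} ¬same
    with ¬∀⟶∃¬ n _ (λ z → (z ∈? S) →-dec (adj G i z ≟ᵇ adj G j z)) ¬same
  ... | z , ¬same-z with z ∈? S
  ...   | yes z∈ = z , z∈ , (λ e → ¬same-z (λ _ → e))
  ...   | no z∉  = ⊥-elim (¬same-z (λ z∈ → ⊥-elim (z∉ z∈)))

BipartiteWith-∁ : ∀ {n} {G : Graph n} {U : Subset n} → BipartiteWith G U → BipartiteWith G (∁ U)
BipartiteWith-∁ (within-U , outside-U) =
  (λ x y x∈ y∈ → outside-U x y (x∈∁p⇒x∉p x∈) (x∈∁p⇒x∉p y∈)) ,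
  (λ x y x∉ y∉ → within-U x y (x∉∁p⇒x∈p x∉) (x∉∁p⇒x∈p y∉))

module Bipartite {n : ℕ} {G : Graph n} {A : Subset n} (bip : BipartiteWith G A) where

  private
    within-A : ∀ {x y} → x ∈ₛ A → y ∈ₛ A → adj G x y ≡ false
    within-A = proj₁ bip _ _

    outside-A : ∀ {x y} → x ∉ₛ A → y ∉ₛ A → adj G x y ≡ false
    outside-A = proj₂ bip _ _

    true≢false : true ≢ false
    true≢false ()

  dominating-⊆-neighbourhood⇒side : ∀ {S x} → Dominating G S → x ∉ₛ A → (∀ z → z ∈ₛ S → adj G x z ≡ true) → S ≡ A
  dominating-⊆-neighbourhood⇒side {S} {x} dom x∉A x-universal = ⊆-antisym S⊆A A⊆S
    where
    S⊆A : S ⊆ A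
    S⊆A {z} z∈S with z ∈? A
    ... | yes z∈A = z∈A
    ... | no z∉A  = ⊥-elim (true≢false (trans (sym (x-universal z z∈S)) (outside-A x∉A z∉A)))
    A⊆S : A ⊆ S
    A⊆S {a} a∈A with a ∈? S
    ... | yes a∈S = a∈S
    ... | no a∉S with dom a a∉S
    ...   | z , z∈S , a~z = ⊥-elim (true≢false (trans (sym a~z) (within-A a∈A (S⊆A z∈S))))

  exchange-LocDom : ∀ {a a′ y} → a ∈ₛ A → a′ ∈ₛ A → a′ ≢ a → y ∉ₛ A → adj G y a ≡ true →
    (∀ i j → i ∉ₛ A → j ∉ₛ A → i ≢ y → j ≢ y → i ≢ j → ∃ λ c → c ∈ₛ A × c ≢ a × adj G i c ≢ adj G j c) →
    LocDom (compl G) ((A - a) ∪ ⁅ y ⁆)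
  exchange-LocDom {a} {a′} {y} a∈A a′∈A a′≢a y∉A y~a separated = Distinguishing-compl G distinguishing , dominating
    where
    T : Subset n
    T = (A - a) ∪ ⁅ y ⁆
    ∈T : ∀ {c} → c ∈ₛ A → c ≢ a → c ∈ₛ T
    ∈T c∈A c≢a = x∈p∪q⁺ (inj₁ (x∈p∧x≢y⇒x∈p-y c∈A c≢a))
    y∈T : y ∈ₛ T
    y∈T = x∈p∪q⁺ (inj₂ (x∈⁅x⁆ y))
    outside-T : ∀ {i} → i ∉ₛ T → i ≢ y × (i ≡ a ⊎ i ∉ₛ A)
    outside-T {i} i∉T = x∉⁅y⁆⇒x≢y (i∉T ∘ x∈p∪q⁺ ∘ inj₂) , a-or-outside
      where
      a-or-outside : i ≡ a ⊎ i ∉ₛ A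
      a-or-outside with i ∈? A | i ≟ a
      ... | no i∉A  | _        = inj₂ i∉A
      ... | yes _   | yes i≡a  = inj₁ i≡a
      ... | yes i∈A | no i≢a   = ⊥-elim (i∉T (∈T i∈A i≢a))
    a~y≢j~y : ∀ {j} → j ∉ₛ A → adj G a y ≢ adj G j y
    a~y≢j~y j∉A a~y≡j~y = true≢false (trans (trans (sym y~a) (Graph.sym G y a)) (trans a~y≡j~y (outside-A j∉A y∉A)))
    distinguishing : Distinguishing G T
    distinguishing i j i∉T j∉T i≢j same with outside-T i∉T | outside-T j∉T
    ... | _ , inj₁ refl | _ , inj₁ refl = i≢j refl
    ... | _ , inj₁ refl | _ , inj₂ j∉A  = a~y≢j~y j∉A (same y y∈T)
    ... | _ , inj₂ i∉A  | _ , inj₁ refl = a~y≢j~y i∉A (sym (same y y∈T))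
    ... | i≢y , inj₂ i∉A | j≢y , inj₂ j∉A with separated i j i∉A j∉A i≢y j≢y i≢j
    ...   | c , c∈A , c≢a , i~c≢j~c = i~c≢j~c (same c (∈T c∈A c≢a))
    dominating : Dominating (compl G) T
    dominating i i∉T with outside-T i∉T
    ... | _   , inj₁ refl = a′ , ∈T a′∈A a′≢a , trans (adj-compl G (a′≢a ∘ sym)) (cong not (within-A a∈A a′∈A))
    ... | i≢y , inj₂ i∉A  = y , y∈T , trans (adj-compl G i≢y) (cong not (outside-A i∉A y∉A))

  ∣exchange∣≤ : ∀ {a} y → a ∈ₛ A → ∣ (A - a) ∪ ⁅ y ⁆ ∣ ≤ ∣ A ∣
  ∣exchange∣≤ {a} y a∈A = begin
    ∣ (A - a) ∪ ⁅ y ⁆ ∣    ≤⟨ ∣p∪q∣≤∣p∣+∣q∣ (A - a) ⁅ y ⁆ ⟩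
    ∣ A - a ∣ + ∣ ⁅ y ⁆ ∣  ≡⟨ cong (∣ A - a ∣ +_) (∣⁅x⁆∣≡1 y) ⟩
    ∣ A - a ∣ + 1          ≡⟨ +-comm ∣ A - a ∣ 1 ⟩
    suc ∣ A - a ∣          ≤⟨ x∈p⇒∣p-x∣<∣p∣ a∈A ⟩
    ∣ A ∣                  ∎
    where open ≤-Reasoning

module OptimalSide {n : ℕ} (G : Graph n) (A : Subset n) (bip : BipartiteWith G A)
  (A-locdom : LocDom G A) (A<λ[Ḡ] : ∀ T → LocDom (compl G) T → ∣ A ∣ < ∣ T ∣) (2≤∣A∣ : 2 ≤ ∣ A ∣)
  {x : Fin n} (x∉A : x ∉ₛ A) (x-universal : ∀ z → z ∈ₛ A → adj G x z ≡ true) where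

  open Bipartite {G = G} {A = A} bip
  open Traces _≟_ _≟_ (adj G)

  as bs : List (Fin n)
  as = elements A
  bs = elements (∁ A)

  ∈bs⇒∉A : ∀ {i} → i ∈ bs → i ∉ₛ A
  ∈bs⇒∉A = x∈∁p⇒x∉p ∘ ∈-elements⁻

  ∉A⇒∈bs : ∀ {i} → i ∉ₛ A → i ∈ bs
  ∉A⇒∈bs = ∈-elements⁺ ∘ x∉p⇒x∈∁p

  bs-separated : Separated as bs
  bs-separated = AllPairs-map-∈ separate (elements-Unique (∁ A))
    where
    separate : ∀ {i j} → i ∈ bs → j ∈ bs → i ≢ j → Separates as i j
    separate i∈ j∈ i≢j with distinguishing-witness G (proj₁ A-locdom _ _ (∈bs⇒∉A i∈) (∈bs⇒∉A j∈) i≢j)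
    ... | z , z∈A , i~z≢j~z = lose (∈-elements⁺ z∈A) i~z≢j~z

  bs-nonzero : All (NonzeroOn as) bs
  bs-nonzero = All.tabulate λ i∈ → let z , z∈A , i~z = proj₂ A-locdom _ (∈bs⇒∉A i∈) in lose (∈-elements⁺ z∈A) i~z

  2≤length-as : 2 ≤ length as
  2≤length-as = subst (2 ≤_) (sym (length-elements A)) 2≤∣A∣

  edge-avoiding : ∀ {a y} → a ∈ₛ A → y ∉ₛ A → adj G y a ≡ true →
    ∃₂ λ p q → p ∈ bs × q ∈ bs × q ≢ y × Edge as a p q
  edge-avoiding {a} {y} a∈A y∉A y~a
    with Any.any? (λ p → Any.any? (λ q → ¬? (p ≟ y) ×-dec ¬? (q ≟ y) ×-dec edge? as a p q) bs) bs
  ... | yes found with find found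
  ...   | p , p∈ , found-q with find found-q
  ...     | q , q∈ , _ , q≢y , e = p , q , p∈ , q∈ , q≢y , e
  -- Otherwise trading a for y would locate and dominate Ḡ with only ∣ A ∣ vertices.
  edge-avoiding {a} {y} a∈A y∉A y~a | no ¬found with ∃≢ _≟_ (elements-Unique A) 2≤length-as a
  ... | a′ , a′∈ , a′≢a =
    ⊥-elim (<-irrefl refl (<-≤-trans (A<λ[Ḡ] _ (exchange-LocDom a∈A (∈-elements⁻ a′∈) a′≢a y∉A y~a separated))
                                     (∣exchange∣≤ y a∈A)))
    where
    separated : ∀ i j → i ∉ₛ A → j ∉ₛ A → i ≢ y → j ≢ y → i ≢ j → ∃ λ c → c ∈ₛ A × c ≢ a × adj G i c ≢ adj G j c
    separated i j i∉A j∉A i≢y j≢y i≢j with separates⇒off⊎edge (Separated-∈ bs-separated (∉A⇒∈bs i∉A) (∉A⇒∈bs j∉A) i≢j)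
    ... | inj₁ off-a        = let c , c∈ , c≢a , differ = find off-a in c , ∈-elements⁻ c∈ , c≢a , differ
    ... | inj₂ (inj₁ i→j)   = ⊥-elim (¬found (lose (∉A⇒∈bs i∉A) (lose (∉A⇒∈bs j∉A) (i≢y , j≢y , i→j))))
    ... | inj₂ (inj₂ j→i)   = ⊥-elim (¬found (lose (∉A⇒∈bs j∉A) (lose (∉A⇒∈bs i∉A) (j≢y , i≢y , j→i))))

  -- The second edge avoids the upper end q₁ of the first, so the two lower ends differ.
  two-edges : ∀ {a} → a ∈ₛ A → HasTwoEdges as bs a
  two-edges a∈A with edge-avoiding a∈A x∉A (x-universal _ a∈A)
  ... | p₁ , q₁ , p₁∈ , q₁∈ , _ , e₁ with edge-avoiding a∈A (∈bs⇒∉A q₁∈) (proj₁ (proj₂ e₁))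
  ...   | p₂ , q₂ , p₂∈ , q₂∈ , q₂≢q₁ , e₂ = lose p₁∈ (lose q₁∈ e₁ , lose p₂∈ (lose q₂∈ e₂ , p₁≢p₂))
    where
    p₁≢p₂ : p₁ ≢ p₂
    p₁≢p₂ refl = q₂≢q₁ (Separated-injective bs-separated q₂∈ q₁∈ (edges-agree e₂ e₁))

  lower-bound : 3 * ∣ A ∣ + 2 ≤ 2 * ∣ ∁ A ∣
  lower-bound = subst₂ (λ r s → 3 * r + 2 ≤ 2 * s) (length-elements A) (length-elements (∁ A))
    (3r≤2pred⇒3r+2≤2s {length as} (∈⇒1≤length (∉A⇒∈bs x∉A))
      (subst₂ (λ c₁ c₂ → 2 * c₁ + c₂ ≤ 2 * pred (length bs)) (every-direction (hasEdge? as bs) (Any.map proj₁ ∘ two-edges))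
        (every-direction (hasTwoEdges? as bs) two-edges) (edge-count as bs (elements-Unique A) bs-separated)))
    where
    every-direction : ∀ {Q : Fin n → Set} (Q? : Decidable Q) → (∀ {a} → a ∈ₛ A → Q a) → count Q? as ≡ length as
    every-direction Q? A⊆Q = cong length (filter-all Q? (All.tabulate (A⊆Q ∘ ∈-elements⁻)))

  upper-bound : ∣ ∁ A ∣ + 1 ≤ 2 ^ ∣ A ∣
  upper-bound = subst₂ (λ s r → s ≤ 2 ^ r) (trans (cong suc (length-elements (∁ A))) (+-comm 1 _)) (length-elements A)
    (Separated-length< as bs-separated bs-nonzero)

optimal-side-bounds : ∀ {n} {G : Graph n} {A S : Subset n} {x} → BipartiteWith G A → LocDom G S →
  (∀ T → LocDom (compl G) T → ∣ S ∣ < ∣ T ∣) → 2 ≤ ∣ A ∣ → x ∉ₛ A → (∀ z → z ∈ₛ S → adj G x z ≡ true) →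
  (3 * ∣ A ∣ + 2 ≤ 2 * ∣ ∁ A ∣) × (∣ ∁ A ∣ + 1 ≤ 2 ^ ∣ A ∣)
optimal-side-bounds {G = G} {A} bip S-locdom S<λ[Ḡ] 2≤∣A∣ x∉A x-universal
  with Bipartite.dominating-⊆-neighbourhood⇒side {G = G} bip (proj₂ S-locdom) x∉A x-universal
... | refl = lower-bound , upper-bound
  where open OptimalSide G A bip S-locdom S<λ[Ḡ] 2≤∣A∣ x∉A x-universal

proposition19 : ∀ (n : ℕ) (G : Graph n) (U : Subset n) →
    Connected G → BipartiteWith G U →
    4 ≤ n → ∣ U ∣ ≤ ∣ ∁ U ∣ → 3 ≤ ∣ U ∣ →
    Σ ℕ (λ k → IsLambda G k × IsLambda (compl G) (suc k)) →
    (3 * ∣ U ∣ + 2 ≤ 2 * ∣ ∁ U ∣) × (∣ ∁ U ∣ + 1 ≤ 2 ^ ∣ U ∣)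
proposition19 n G U _ bip _ r≤s 3≤r (k , ((S , S-locdom , refl) , _) , (_ , λ[Ḡ]-minimal))
  with ¬Dominating-compl⇒universal G (λ dom → <-irrefl refl (λ[Ḡ]-minimal S (Distinguishing-compl G (proj₁ S-locdom) , dom)))
... | x , _ , x-universal with x ∈? U
...   | no x∉U  = optimal-side-bounds {G = G} {S = S} bip S-locdom λ[Ḡ]-minimal (≤-trans (n≤1+n 2) 3≤r) x∉U x-universal
...   | yes x∈U = ⊥-elim (<⇒≱ (3s+2≤2r⇒s<r (subst (λ p → 3 * ∣ ∁ U ∣ + 2 ≤ 2 * ∣ p ∣) (∁-involutive U) W-bounds)) r≤s)
  where
  W-bounds : 3 * ∣ ∁ U ∣ + 2 ≤ 2 * ∣ ∁ (∁ U) ∣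
  W-bounds = proj₁ (optimal-side-bounds {G = G} {S = S} (BipartiteWith-∁ {G = G} {U = U} bip) S-locdom λ[Ḡ]-minimal
                      (≤-trans (n≤1+n 2) (≤-trans 3≤r r≤s)) (x∈p⇒x∉∁p x∈U) x-universal)
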